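{- Every term $t\in\mathcal{T}$ reduces (for $\to$) to a possibly empty sum of simple terms, where the empty sum is identified with $\mathbf{0}$.
   Context: Let $\mathbb{Z}_\infty=\mathbb{Z}\cup\{\infty\}$, with $\infty+n=n+\infty=\infty+\infty=\infty$. The set $\mathcal{T}$ of terms is generated by $t ::= \mathtt{x} \mid \mathtt{C}\,t \mid (t_1,\dots,t_n) \mid \overline{\mathtt{C}}\,t \mid \pi_i t \mid t_1+t_2 \mid \mathbf{0} \mid \langle w\rangle t$ ($\mathtt{x}$ a variable, $\mathtt{C}$ a constructor name, $n\ge0$, $i\ge1$, $w\in\mathbb{Z}_\infty$), quotiented by: every term former ($\mathtt{C}\,\cdot$, $\overline{\mathtt{C}}\,\cdot$, $\pi_i\cdot$, $\langle w\rangle\cdot$, each tuple component) sends $\mathbf{0}$ to $\mathbf{0}$ and distributes over $+$; $+$ is associative, commutative, idempotent with neutral $\mathbf{0}$. The reduction $\to$ is the contextual closure of: $\overline{\mathtt{C}}\,\mathtt{C}\,t\to t$; $\pi_i(t_1,\dots,t_n)\to t_i$ ($1\le i\le n$); $\langle w\rangle\mathtt{C}\,t\to\langle w+1\rangle t$; $\langle w\rangle(t_1,\dots,t_n)\to\sum_{i}\langle w+1\rangle t_i$ ($n>0$); $\overline{\mathtt{C}}\langle w\rangle t\to\langle w-1\rangle t$; $\pi_i\langle w\rangle t\to\langle w-1\rangle t$; $\langle w\rangle\langle v\rangle t\to\langle w+v\rangle t$; $\pi_i\,\mathtt{C}\,t\to\mathbf{0}$; $\pi_i(t_1,\dots,t_n)\to\mathbf{0}$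 ($i>n$); $\overline{\mathtt{C}}(t_1,\dots,t_n)\to\mathbf{0}$; $\overline{\mathtt{C}}\,\mathtt{D}\,t\to\mathbf{0}$ ($\mathtt{C}\ne\mathtt{D}$). A term is simple if it is in normal form for $\to$ and contains neither $+$ nor $\mathbf{0}$. -}

module Defs where

open import Data.Nat using (ℕ; zero; suc; _≤_)
open import Data.Integer using (ℤ) renaming (_+_ to _+ℤ_; -_ to -ℤ_)
import Data.Integer as ℤ
open import Data.List using (List; []; _∷_; _++_; length; map; foldr)
open import Data.List.Relation.Unary.All using (All)
open import Data.Product using (Σ; _×_; _,_; ∃)
open import Relation.Binary.PropositionalEquality using (_≡_)
open import Relation.Nullary using (¬_)

data ℤ∞ : Set where
  fin : ℤ → ℤ∞
  ∞   : ℤ∞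

infixl 6 _+∞_
_+∞_ : ℤ∞ → ℤ∞ → ℤ∞
fin a +∞ fin b = fin (a +ℤ b)
fin _ +∞ ∞     = ∞
∞     +∞ _     = ∞

one∞ : ℤ∞
one∞ = fin (ℤ.+ 1)

minusOne∞ : ℤ∞
minusOne∞ = fin (ℤ.-[1+ 0 ])

-- Raw terms.  Variables and constructor names are natural numbers.
-- `π k t` denotes the projection π_{k+1} t (so indices i ≥ 1 are
-- represented by k = i - 1 ≥ 0).

infixl 5 _⊕_

data Term : Set where
  var   : ℕ → Term
  con   : ℕ → Term → Term
  tup   : List Term → Term
  dcon  : ℕ → Term → Term
  π     : ℕ → Term → Term
  _⊕_   : Term → Term → Term
  𝟘     : Term
  wt    : ℤ∞ → Term → Term

Σ⊕ : List Term → Term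
Σ⊕ = foldr _⊕_ 𝟘

-- The equational theory defining the quotient 𝒯 (a congruence).

infix 4 _≈_
data _≈_ : Term → Term → Set where
  ≈-refl  : ∀ {t} → t ≈ t
  ≈-sym   : ∀ {t u} → t ≈ u → u ≈ t
  ≈-trans : ∀ {t u v} → t ≈ u → u ≈ v → t ≈ v
  c-con  : ∀ {c t u} → t ≈ u → con c t ≈ con c u
  c-dcon : ∀ {c t u} → t ≈ u → dcon c t ≈ dcon c u
  c-π    : ∀ {k t u} → t ≈ u → π k t ≈ π k u
  c-wt   : ∀ {w t u} → t ≈ u → wt w t ≈ wt w u
  c-tup  : ∀ {ts us t u} → t ≈ u → tup (ts ++ t ∷ us) ≈ tup (ts ++ u ∷ us)
  c-⊕    : ∀ {t t' u u'} → t ≈ t' → u ≈ u' → t ⊕ u ≈ t' ⊕ u'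
  z-con  : ∀ {c} → con c 𝟘 ≈ 𝟘
  z-dcon : ∀ {c} → dcon c 𝟘 ≈ 𝟘
  z-π    : ∀ {k} → π k 𝟘 ≈ 𝟘
  z-wt   : ∀ {w} → wt w 𝟘 ≈ 𝟘
  z-tup  : ∀ {ts us} → tup (ts ++ 𝟘 ∷ us) ≈ 𝟘
  d-con  : ∀ {c t u} → con c (t ⊕ u) ≈ con c t ⊕ con c u
  d-dcon : ∀ {c t u} → dcon c (t ⊕ u) ≈ dcon c t ⊕ dcon c u
  d-π    : ∀ {k t u} → π k (t ⊕ u) ≈ π k t ⊕ π k u
  d-wt   : ∀ {w t u} → wt w (t ⊕ u) ≈ wt w t ⊕ wt w u
  d-tup  : ∀ {ts us t u} →
           tup (ts ++ (t ⊕ u) ∷ us) ≈ tup (ts ++ t ∷ us) ⊕ tup (ts ++ u ∷ us)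
  ⊕-assoc : ∀ {t u v} → (t ⊕ u) ⊕ v ≈ t ⊕ (u ⊕ v)
  ⊕-comm  : ∀ {t u} → t ⊕ u ≈ u ⊕ t
  ⊕-idem  : ∀ {t} → t ⊕ t ≈ t
  ⊕-unit  : ∀ {t} → t ⊕ 𝟘 ≈ t

infix 4 _↦_
data _↦_ : Term → Term → Set where
  r-dcon-con : ∀ {c t} → dcon c (con c t) ↦ t
  r-π-tup    : ∀ {k ts t us} → length ts ≡ k → π k (tup (ts ++ t ∷ us)) ↦ t
  r-wt-con   : ∀ {w c t} → wt w (con c t) ↦ wt (w +∞ one∞) t
  r-wt-tup   : ∀ {w t ts} →
               wt w (tup (t ∷ ts)) ↦ Σ⊕ (map (wt (w +∞ one∞)) (t ∷ ts))
  r-dcon-wt  : ∀ {c w t} → dcon c (wt w t) ↦ wt (w +∞ minusOne∞) t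
  r-π-wt     : ∀ {k w t} → π k (wt w t) ↦ wt (w +∞ minusOne∞) t
  r-wt-wt    : ∀ {w v t} → wt w (wt v t) ↦ wt (w +∞ v) t
  r-π-con    : ∀ {k c t} → π k (con c t) ↦ 𝟘
  r-π-out    : ∀ {k ts} → length ts ≤ k → π k (tup ts) ↦ 𝟘
  r-dcon-tup : ∀ {c ts} → dcon c (tup ts) ↦ 𝟘
  r-dcon-clash : ∀ {c d t} → ¬ (c ≡ d) → dcon c (con d t) ↦ 𝟘

infix 4 _⟶_
data _⟶_ : Term → Term → Set where
  root  : ∀ {t u} → t ↦ u → t ⟶ u
  s-con  : ∀ {c t u} → t ⟶ u → con c t ⟶ con c u
  s-dcon : ∀ {c t u} → t ⟶ u → dcon c t ⟶ dcon c u
  s-π    : ∀ {k t u} → t ⟶ u → π k t ⟶ π k u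
  s-wt   : ∀ {w t u} → t ⟶ u → wt w t ⟶ wt w u
  s-tup  : ∀ {ts us t u} → t ⟶ u → tup (ts ++ t ∷ us) ⟶ tup (ts ++ u ∷ us)
  s-⊕ˡ   : ∀ {t t' u} → t ⟶ t' → t ⊕ u ⟶ t' ⊕ u
  s-⊕ʳ   : ∀ {t u u'} → u ⟶ u' → t ⊕ u ⟶ t ⊕ u'

-- Reduction on 𝒯 (i.e. modulo ≈): t → u iff t ≈ t' ⟶ u' ≈ u.
infix 4 _⇒_
_⇒_ : Term → Term → Set
t ⇒ u = Σ Term λ t' → Σ Term λ u' → (t ≈ t') × (t' ⟶ u') × (u' ≈ u)

-- Reflexive–transitive closure (also closed under ≈, so that the
-- reflexive case is reflexivity in 𝒯).
infix 4 _⇒*_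
data _⇒*_ : Term → Term → Set where
  done : ∀ {t u} → t ≈ u → t ⇒* u
  step : ∀ {t u v} → t ⇒ u → u ⇒* v → t ⇒* v

data PlusZeroFree : Term → Set where
  pz-var  : ∀ {x} → PlusZeroFree (var x)
  pz-con  : ∀ {c t} → PlusZeroFree t → PlusZeroFree (con c t)
  pz-tup  : ∀ {ts} → All PlusZeroFree ts → PlusZeroFree (tup ts)
  pz-dcon : ∀ {c t} → PlusZeroFree t → PlusZeroFree (dcon c t)
  pz-π    : ∀ {k t} → PlusZeroFree t → PlusZeroFree (π k t)
  pz-wt   : ∀ {w t} → PlusZeroFree t → PlusZeroFree (wt w t)

NormalForm : Term → Set
NormalForm t = ∀ u → ¬ (t ⟶ u)

Simple : Term → Set
Simple t = PlusZeroFree t × NormalForm t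

-- Normalisation is compositional.  Every term former F is linear (it sends 0 to
-- 0 and distributes over +), so from t ⇒* s₁ + … + sₙ with simple sᵢ we get
-- F t ⇒* F s₁ + … + F sₙ, and it remains to normalise F s for simple s.  For
-- tuples this is multilinear expansion.  For C̄, πᵢ and ⟨w⟩ only a head redex
-- can remain; contracting it leaves simple subterms of s, possibly under a
-- weight, and weights are pushed inward until they reach a neutral term (a
-- variable, C̄ u or πᵢ u) or the empty tuple.
module Submission where

open import Defs
open import Data.Nat using (ℕ; zero; suc; _≤_; z≤n; s≤s; _≟_)
open import Data.List using (List; []; _∷_; _++_; [_]; length; map; concatMap)
open import Data.List.Properties using (++-assoc; ++-identityʳ)
open import Data.List.Membership.Propositional using (_∈_)
open import Data.List.Membership.Propositional.Properties using (∈-insert; ∈-∃++)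
open import Data.List.Relation.Unary.All using (All; []; _∷_)
import Data.List.Relation.Unary.All as All
import Data.List.Relation.Unary.All.Properties as All
open import Data.Product using (Σ; _×_; _,_; proj₁; proj₂)
open import Relation.Nullary using (¬_; yes; no)
open import Relation.Binary.PropositionalEquality using (_≡_; refl; cong; subst)

private
  variable
    A B : Set
    P Q : A → Set
    c : ℕ
    k : ℕ
    w : ℤ∞
    s t u v : Term
    ts : List Term

infixr 5 _◅◅_

≈-◅◅ : t ≈ u → u ⇒* v → t ⇒* v
≈-◅◅ e (done e′) = done (≈-trans e e′)
≈-◅◅ e (step (a , b , e₁ , r , e₂) rs) = step (a , b , ≈-trans e e₁ , r , e₂) rs

_◅◅_ : t ⇒* u → u ⇒* v → t ⇒* v
done e    ◅◅ rs′ = ≈-◅◅ e rs′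
step r rs ◅◅ rs′ = step r (rs ◅◅ rs′)

⟶⇒⇒* : t ⟶ u → t ⇒* u
⟶⇒⇒* r = step (_ , _ , ≈-refl , r , ≈-refl) (done ≈-refl)

⇒*-cong : (F : Term → Term) →
          (∀ {t u} → t ≈ u → F t ≈ F u) → (∀ {t u} → t ⟶ u → F t ⟶ F u) →
          t ⇒* u → F t ⇒* F u
⇒*-cong F ≈-cong ⟶-cong (done e) = done (≈-cong e)
⇒*-cong F ≈-cong ⟶-cong (step (a , b , e₁ , r , e₂) rs) =
  step (F a , F b , ≈-cong e₁ , ⟶-cong r , ≈-cong e₂) (⇒*-cong F ≈-cong ⟶-cong rs)

⊕-⇒* : ∀ {t t' u u'} → t ⇒* t' → u ⇒* u' → t ⊕ u ⇒* t' ⊕ u'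
⊕-⇒* {t' = t'} {u} rs rs′ =
  ⇒*-cong (_⊕ u) (λ e → c-⊕ e ≈-refl) s-⊕ˡ rs ◅◅
  ⇒*-cong (t' ⊕_) (c-⊕ ≈-refl) s-⊕ʳ rs′

Σ⊕-singleton : t ≈ Σ⊕ [ t ]
Σ⊕-singleton = ≈-sym ⊕-unit

Σ⊕-++ : ∀ xs ys → Σ⊕ (xs ++ ys) ≈ Σ⊕ xs ⊕ Σ⊕ ys
Σ⊕-++ []       ys = ≈-sym (≈-trans ⊕-comm ⊕-unit)
Σ⊕-++ (x ∷ xs) ys = ≈-trans (c-⊕ ≈-refl (Σ⊕-++ xs ys)) (≈-sym ⊕-assoc)

⊕-⇒*-++ : ∀ xs ys → t ⇒* Σ⊕ xs → u ⇒* Σ⊕ ys → t ⊕ u ⇒* Σ⊕ (xs ++ ys)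
⊕-⇒*-++ xs ys rs rs′ = ⊕-⇒* rs rs′ ◅◅ done (≈-sym (Σ⊕-++ xs ys))

Σ⊕-map-⇒* : {g : A → Term} {h : A → List Term} →
            (∀ x → g x ⇒* Σ⊕ (h x)) → ∀ xs → Σ⊕ (map g xs) ⇒* Σ⊕ (concatMap h xs)
Σ⊕-map-⇒*         g⇒*h []       = done ≈-refl
Σ⊕-map-⇒* {h = h} g⇒*h (x ∷ xs) =
  ⊕-⇒*-++ (h x) (concatMap h xs) (g⇒*h x) (Σ⊕-map-⇒* g⇒*h xs)

record Linear (F : Term → Term) : Set where
  field
    ≈-cong  : ∀ {t u} → t ≈ u → F t ≈ F u
    ⟶-cong  : ∀ {t u} → t ⟶ u → F t ⟶ F u
    F-𝟘     : F 𝟘 ≈ 𝟘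
    F-⊕     : ∀ {t u} → F (t ⊕ u) ≈ F t ⊕ F u

  Σ⊕-map : ∀ ts → F (Σ⊕ ts) ≈ Σ⊕ (map F ts)
  Σ⊕-map []       = F-𝟘
  Σ⊕-map (t ∷ ts) = ≈-trans F-⊕ (c-⊕ ≈-refl (Σ⊕-map ts))

  map-⇒* : ∀ ss → t ⇒* Σ⊕ ss → F t ⇒* Σ⊕ (map F ss)
  map-⇒* ss rs = ⇒*-cong F ≈-cong ⟶-cong rs ◅◅ done (Σ⊕-map ss)

  concatMap-⇒* : {h : Term → List Term} →
                 ∀ ss → (∀ s → F s ⇒* Σ⊕ (h s)) → t ⇒* Σ⊕ ss → F t ⇒* Σ⊕ (concatMap h ss)
  concatMap-⇒* ss F⇒*h rs = map-⇒* ss rs ◅◅ Σ⊕-map-⇒* F⇒*h ss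

con-linear : Linear (con c)
con-linear = record { ≈-cong = c-con ; ⟶-cong = s-con ; F-𝟘 = z-con ; F-⊕ = d-con }

dcon-linear : Linear (dcon c)
dcon-linear = record { ≈-cong = c-dcon ; ⟶-cong = s-dcon ; F-𝟘 = z-dcon ; F-⊕ = d-dcon }

π-linear : Linear (π k)
π-linear = record { ≈-cong = c-π ; ⟶-cong = s-π ; F-𝟘 = z-π ; F-⊕ = d-π }

wt-linear : Linear (wt w)
wt-linear = record { ≈-cong = c-wt ; ⟶-cong = s-wt ; F-𝟘 = z-wt ; F-⊕ = d-wt }

tup-linear : ∀ ps us → Linear (λ t → tup (ps ++ t ∷ us))
tup-linear ps us = record
  { ≈-cong = c-tup {ps} {us} ; ⟶-cong = s-tup {ps} {us}
  ; F-𝟘 = z-tup {ps} {us} ; F-⊕ = d-tup {ps} {us} }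

data Neutral : Term → Set where
  var  : ∀ {x} → Neutral (var x)
  dcon : Neutral (dcon c s)
  π    : Neutral (π k s)

dcon-neutral-↛ : Neutral s → ¬ (dcon c s ↦ u)
dcon-neutral-↛ var  ()
dcon-neutral-↛ dcon ()
dcon-neutral-↛ π    ()

π-neutral-↛ : Neutral s → ¬ (π k s ↦ u)
π-neutral-↛ var  ()
π-neutral-↛ dcon ()
π-neutral-↛ π    ()

wt-neutral-↛ : Neutral s → ¬ (wt w s ↦ u)
wt-neutral-↛ var  ()
wt-neutral-↛ dcon ()
wt-neutral-↛ π    ()

Simple-con⁺ : Simple s → Simple (con c s)
Simple-con⁺ (p , n) = pz-con p , λ where
  _ (root ())
  _ (s-con r) → n _ r

Simple-dcon⁺ : Neutral s → Simple s → Simple (dcon c s)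
Simple-dcon⁺ ν (p , n) = pz-dcon p , λ where
  _ (root ρ)   → dcon-neutral-↛ ν ρ
  _ (s-dcon r) → n _ r

Simple-π⁺ : Neutral s → Simple s → Simple (π k s)
Simple-π⁺ ν (p , n) = pz-π p , λ where
  _ (root ρ) → π-neutral-↛ ν ρ
  _ (s-π r)  → n _ r

Simple-wt⁺ : Neutral s → Simple s → Simple (wt w s)
Simple-wt⁺ ν (p , n) = pz-wt p , λ where
  _ (root ρ) → wt-neutral-↛ ν ρ
  _ (s-wt r) → n _ r

Simple-tup⁺ : All Simple ts → Simple (tup ts)
Simple-tup⁺ σs = pz-tup (All.map proj₁ σs) , λ where
  _ (root ())
  _ (s-tup {ps} r) → proj₂ (All.lookup σs (∈-insert ps)) _ r

Simple-wt-tup[] : Simple (wt w (tup []))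
Simple-wt-tup[] with p , n ← Simple-tup⁺ [] = pz-wt p , λ where
  _ (root ())
  _ (s-wt r) → n _ r

Simple-con⁻ : Simple (con c s) → Simple s
Simple-con⁻ (pz-con p , n) = p , λ _ r → n _ (s-con r)

Simple-wt⁻ : Simple (wt w s) → Simple s
Simple-wt⁻ (pz-wt p , n) = p , λ _ r → n _ (s-wt r)

Simple-tup⁻ : Simple (tup ts) → All Simple ts
Simple-tup⁻ {ts} (pz-tup p , n) = All.zip (p , All.tabulate component-normal)
  where
  component-normal : ∀ {s} → s ∈ ts → NormalForm s
  component-normal s∈ts u r with ps , us , refl ← ∈-∃++ s∈ts = n _ (s-tup {ps} {us} r)

data Projection {A : Set} (k : ℕ) : List A → Set where
  inside  : ∀ ps x us → length ps ≡ k → Projection k (ps ++ x ∷ us)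
  outside : ∀ {xs} → length xs ≤ k → Projection k xs

projection : ∀ k (xs : List A) → Projection k xs
projection k       []       = outside z≤n
projection zero    (x ∷ xs) = inside [] x xs refl
projection (suc k) (x ∷ xs) with projection k xs
... | inside ps y us l = inside (x ∷ ps) y us (cong suc l)
... | outside l        = outside (s≤s l)

All-concatMap⁺ : {f : A → List B} → (∀ {x} → P x → All Q (f x)) →
                 ∀ {xs} → All P xs → All Q (concatMap f xs)
All-concatMap⁺ f⁺ pxs = All.concat⁺ (All.map⁺ (All.map f⁺ pxs))

-- The clauses for arguments containing + or 0 are junk: these functions are
-- only applied to simple terms.
mutual
  wt-nf : ℤ∞ → Term → List Term
  wt-nf w (con c s)      = wt-nf (w +∞ one∞) s
  wt-nf w (tup [])       = [ wt w (tup []) ]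
  wt-nf w (tup (s ∷ ss)) = wt-nfs (w +∞ one∞) (s ∷ ss)
  wt-nf w (wt v s)       = wt-nf (w +∞ v) s
  wt-nf w s              = [ wt w s ]

  wt-nfs : ℤ∞ → List Term → List Term
  wt-nfs w []       = []
  wt-nfs w (s ∷ ss) = wt-nf w s ++ wt-nfs w ss

dcon-nf : ℕ → Term → List Term
dcon-nf c (con d s) with c ≟ d
... | yes _ = [ s ]
... | no  _ = []
dcon-nf c (tup _)  = []
dcon-nf c (wt w s) = wt-nf (w +∞ minusOne∞) s
dcon-nf c s        = [ dcon c s ]

π-nf : ℕ → Term → List Term
π-nf k (con _ _) = []
π-nf k (tup ts) with projection k ts
... | inside _ t _ _ = [ t ]
... | outside _      = []
π-nf k (wt w s)  = wt-nf (w +∞ minusOne∞) s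
π-nf k s         = [ π k s ]

mutual
  wt-nf-⇒* : ∀ w s → wt w s ⇒* Σ⊕ (wt-nf w s)
  wt-nf-⇒* w (con c s)      = ⟶⇒⇒* (root r-wt-con) ◅◅ wt-nf-⇒* _ s
  wt-nf-⇒* w (tup [])       = done Σ⊕-singleton
  wt-nf-⇒* w (tup (s ∷ ss)) = ⟶⇒⇒* (root r-wt-tup) ◅◅ wt-nfs-⇒* _ (s ∷ ss)
  wt-nf-⇒* w (wt v s)       = ⟶⇒⇒* (root r-wt-wt) ◅◅ wt-nf-⇒* _ s
  wt-nf-⇒* w (var x)        = done Σ⊕-singleton
  wt-nf-⇒* w (dcon c s)     = done Σ⊕-singleton
  wt-nf-⇒* w (π k s)        = done Σ⊕-singleton
  wt-nf-⇒* w (s ⊕ s′)       = done Σ⊕-singleton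
  wt-nf-⇒* w 𝟘              = done Σ⊕-singleton

  wt-nfs-⇒* : ∀ w ss → Σ⊕ (map (wt w) ss) ⇒* Σ⊕ (wt-nfs w ss)
  wt-nfs-⇒* w []       = done ≈-refl
  wt-nfs-⇒* w (s ∷ ss) = ⊕-⇒*-++ (wt-nf w s) (wt-nfs w ss) (wt-nf-⇒* w s) (wt-nfs-⇒* w ss)

mutual
  wt-nf-simple : ∀ w s → Simple s → All Simple (wt-nf w s)
  wt-nf-simple w (con c s)      σ = wt-nf-simple _ s (Simple-con⁻ σ)
  wt-nf-simple w (tup [])       σ = Simple-wt-tup[] ∷ []
  wt-nf-simple w (tup (s ∷ ss)) σ = wt-nfs-simple _ (s ∷ ss) (Simple-tup⁻ σ)
  wt-nf-simple w (wt v s)       σ = wt-nf-simple _ s (Simple-wt⁻ σ)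
  wt-nf-simple w (var x)        σ = Simple-wt⁺ var σ ∷ []
  wt-nf-simple w (dcon c s)     σ = Simple-wt⁺ dcon σ ∷ []
  wt-nf-simple w (π k s)        σ = Simple-wt⁺ π σ ∷ []
  wt-nf-simple w (s ⊕ s′)       (() , _)
  wt-nf-simple w 𝟘              (() , _)

  wt-nfs-simple : ∀ w ss → All Simple ss → All Simple (wt-nfs w ss)
  wt-nfs-simple w []       []       = []
  wt-nfs-simple w (s ∷ ss) (σ ∷ σs) = All.++⁺ (wt-nf-simple w s σ) (wt-nfs-simple w ss σs)

dcon-nf-⇒* : ∀ c s → dcon c s ⇒* Σ⊕ (dcon-nf c s)
dcon-nf-⇒* c (con d s) with c ≟ d
... | yes refl = ⟶⇒⇒* (root r-dcon-con) ◅◅ done Σ⊕-singleton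
... | no  c≢d  = ⟶⇒⇒* (root (r-dcon-clash c≢d))
dcon-nf-⇒* c (tup ts)   = ⟶⇒⇒* (root r-dcon-tup)
dcon-nf-⇒* c (wt w s)   = ⟶⇒⇒* (root r-dcon-wt) ◅◅ wt-nf-⇒* _ s
dcon-nf-⇒* c (var x)    = done Σ⊕-singleton
dcon-nf-⇒* c (dcon d s) = done Σ⊕-singleton
dcon-nf-⇒* c (π k s)    = done Σ⊕-singleton
dcon-nf-⇒* c (s ⊕ s′)   = done Σ⊕-singleton
dcon-nf-⇒* c 𝟘          = done Σ⊕-singleton

dcon-nf-simple : ∀ c s → Simple s → All Simple (dcon-nf c s)
dcon-nf-simple c (con d s) σ with c ≟ d
... | yes _ = Simple-con⁻ σ ∷ []
... | no  _ = []
dcon-nf-simple c (tup ts)   σ = []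
dcon-nf-simple c (wt w s)   σ = wt-nf-simple _ s (Simple-wt⁻ σ)
dcon-nf-simple c (var x)    σ = Simple-dcon⁺ var σ ∷ []
dcon-nf-simple c (dcon d s) σ = Simple-dcon⁺ dcon σ ∷ []
dcon-nf-simple c (π k s)    σ = Simple-dcon⁺ π σ ∷ []
dcon-nf-simple c (s ⊕ s′)   (() , _)
dcon-nf-simple c 𝟘          (() , _)

π-nf-⇒* : ∀ k s → π k s ⇒* Σ⊕ (π-nf k s)
π-nf-⇒* k (con c s) = ⟶⇒⇒* (root r-π-con)
π-nf-⇒* k (tup ts) with projection k ts
... | inside ps t us l = ⟶⇒⇒* (root (r-π-tup l)) ◅◅ done Σ⊕-singleton
... | outside l        = ⟶⇒⇒* (root (r-π-out l))
π-nf-⇒* k (wt w s)   = ⟶⇒⇒* (root r-π-wt) ◅◅ wt-nf-⇒* _ s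
π-nf-⇒* k (var x)    = done Σ⊕-singleton
π-nf-⇒* k (dcon d s) = done Σ⊕-singleton
π-nf-⇒* k (π j s)    = done Σ⊕-singleton
π-nf-⇒* k (s ⊕ s′)   = done Σ⊕-singleton
π-nf-⇒* k 𝟘          = done Σ⊕-singleton

π-nf-simple : ∀ k s → Simple s → All Simple (π-nf k s)
π-nf-simple k (con c s) σ = []
π-nf-simple k (tup ts) σ with projection k ts
... | inside ps t us _ = All.lookup (Simple-tup⁻ σ) (∈-insert ps) ∷ []
... | outside _        = []
π-nf-simple k (wt w s)   σ = wt-nf-simple _ s (Simple-wt⁻ σ)
π-nf-simple k (var x)    σ = Simple-π⁺ var σ ∷ []
π-nf-simple k (dcon d s) σ = Simple-π⁺ dcon σ ∷ []
π-nf-simple k (π j s)    σ = Simple-π⁺ π σ ∷ []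
π-nf-simple k (s ⊕ s′)   (() , _)
π-nf-simple k 𝟘          (() , _)

-- nf-tup ps ts lists the simple summands of tup (ps ++ ts) when ps is already simple.
mutual
  nf : Term → List Term
  nf (var x)    = [ var x ]
  nf (con c t)  = map (con c) (nf t)
  nf (tup ts)   = nf-tup [] ts
  nf (dcon c t) = concatMap (dcon-nf c) (nf t)
  nf (π k t)    = concatMap (π-nf k) (nf t)
  nf (wt w t)   = concatMap (wt-nf w) (nf t)
  nf (t ⊕ u)    = nf t ++ nf u
  nf 𝟘          = []

  nf-tup : List Term → List Term → List Term
  nf-tup ps []       = [ tup ps ]
  nf-tup ps (t ∷ ts) = concatMap (λ s → nf-tup (ps ++ [ s ]) ts) (nf t)

mutual
  nf-⇒* : ∀ t → t ⇒* Σ⊕ (nf t)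
  nf-⇒* (var x)    = done Σ⊕-singleton
  nf-⇒* (con c t)  = Linear.map-⇒* con-linear (nf t) (nf-⇒* t)
  nf-⇒* (tup ts)   = nf-tup-⇒* [] ts
  nf-⇒* (dcon c t) = Linear.concatMap-⇒* dcon-linear (nf t) (dcon-nf-⇒* c) (nf-⇒* t)
  nf-⇒* (π k t)    = Linear.concatMap-⇒* π-linear (nf t) (π-nf-⇒* k) (nf-⇒* t)
  nf-⇒* (wt w t)   = Linear.concatMap-⇒* wt-linear (nf t) (wt-nf-⇒* w) (nf-⇒* t)
  nf-⇒* (t ⊕ u)    = ⊕-⇒*-++ (nf t) (nf u) (nf-⇒* t) (nf-⇒* u)
  nf-⇒* 𝟘          = done ≈-refl

  nf-tup-⇒* : ∀ ps ts → tup (ps ++ ts) ⇒* Σ⊕ (nf-tup ps ts)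
  nf-tup-⇒* ps [] rewrite ++-identityʳ ps = done Σ⊕-singleton
  nf-tup-⇒* ps (t ∷ ts) = Linear.concatMap-⇒* (tup-linear ps ts) (nf t) extend-prefix (nf-⇒* t)
    where
    extend-prefix : ∀ s → tup (ps ++ s ∷ ts) ⇒* Σ⊕ (nf-tup (ps ++ [ s ]) ts)
    extend-prefix s = subst (λ qs → tup qs ⇒* Σ⊕ (nf-tup (ps ++ [ s ]) ts))
                            (++-assoc ps [ s ] ts) (nf-tup-⇒* (ps ++ [ s ]) ts)

mutual
  nf-simple : ∀ t → All Simple (nf t)
  nf-simple (var x)    = (pz-var , λ _ → λ { (root ()) }) ∷ []
  nf-simple (con c t)  = All.map⁺ (All.map Simple-con⁺ (nf-simple t))
  nf-simple (tup ts)   = nf-tup-simple [] ts []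
  nf-simple (dcon c t) = All-concatMap⁺ (dcon-nf-simple c _) (nf-simple t)
  nf-simple (π k t)    = All-concatMap⁺ (π-nf-simple k _) (nf-simple t)
  nf-simple (wt w t)   = All-concatMap⁺ (wt-nf-simple w _) (nf-simple t)
  nf-simple (t ⊕ u)    = All.++⁺ (nf-simple t) (nf-simple u)
  nf-simple 𝟘          = []

  nf-tup-simple : ∀ ps ts → All Simple ps → All Simple (nf-tup ps ts)
  nf-tup-simple ps []       σs = Simple-tup⁺ σs ∷ []
  nf-tup-simple ps (t ∷ ts) σs =
    All-concatMap⁺ (λ {s} σ → nf-tup-simple (ps ++ [ s ]) ts (All.++⁺ σs (σ ∷ []))) (nf-simple t)

lemma1p4 : (t : Term) → Σ (List Term) λ ss → All Simple ss × (t ⇒* Σ⊕ ss)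
lemma1p4 t = nf t , nf-simple t , nf-⇒* t
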